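{- In the setting described in the context, no set $u\in A$ receives more than $w(u)$ in Step 1.
   Context: Setting: $\mathcal{S}$ is an instance of the hereditary $3$-set packing problem, i.e., a finite family of nonempty sets of cardinality at most $3$ such that every nonempty subset of a member is a member; $w(s)=|s|-1$, $w(X)=\sum_{s\in X}w(s)$. A feasible solution is a subfamily of pairwise disjoint sets. $N(U,W)=\{x\in W:\exists u\in U:u\cap x\ne\emptyset\}$. A family $X\subseteq\mathcal{S}$ of pairwise disjoint sets is a local improvement of a feasible solution $A$ of size $|X|$ if $w(X)>w(N(X,A))$, or $w(X)=w(N(X,A))$ and $X$ contains more sets of weight $2$ than $N(X,A)$. $A$ is a feasible solution with no local improvement of size at most $10$ and $B$ is an optimum feasible solution; $A$ and $B$ consist of sets of cardinality $2$ or $3$ (sets of size $1$ are ignored). The conflict graph $G$ is the bipartite multigraph on $A\dot\cup B$ with exactly $|a\cap b|$ parallel edges between $a\in A$ and $b\in B$; neighbors and incident edges refer to $G$. $B_1$ is the set of $v\in B$ with exactly one neighbor in $A$; $B_2$ is the set of $v\in B$ with $w(v)=2$ having exactly two incident edges whose endpoints in $A$ are distinct. Step 1: each $v\in B_1$ sends $w(v)$ to its unique neighbor in $A$, and each $v\in B_2$ sends $1$ along each of its two edges. -}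

module Defs where

open import Data.Nat using (ℕ; _≤_; _<_; _∸_; _≟_; _≤?_)
open import Data.Bool using (if_then_else_)
open import Data.Fin.Subset as FS using (Subset; _∩_; ∣_∣; Nonempty)
open import Data.List using (List; length; filter; map)
open import Data.Nat.ListAction using (sum)
open import Data.List.Membership.Propositional using (_∈_)
open import Data.List.Relation.Unary.Any using (Any)
open import Data.List.Relation.Unary.All using (All)
open import Data.List.Relation.Unary.AllPairs using (AllPairs)
open import Data.Product using (_×_)
open import Data.Sum using (_⊎_)
open import Relation.Binary.PropositionalEquality using (_≡_)
open import Relation.Nullary using (Dec; does; ¬_)
open import Relation.Nullary.Decidable using (_×-dec_)

w : ∀ {n} → Subset n → ℕ
w s = ∣ s ∣ ∸ 1

wF : ∀ {n} → List (Subset n) → ℕ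
wF X = sum (map w X)

count2 : ∀ {n} → List (Subset n) → ℕ
count2 X = length (filter (λ s → w s ≟ 2) X)

Disjoint : ∀ {n} → Subset n → Subset n → Set
Disjoint u v = ∣ u ∩ v ∣ ≡ 0

meets? : ∀ {n} (u v : Subset n) → Dec (1 ≤ ∣ u ∩ v ∣)
meets? u v = 1 ≤? ∣ u ∩ v ∣

Hereditary3 : ∀ {n} → List (Subset n) → Set
Hereditary3 {n} S =
  All (λ s → Nonempty s × ∣ s ∣ ≤ 3) S ×
  (∀ s → s ∈ S → ∀ (t : Subset n) → t FS.⊆ s → Nonempty t → t ∈ S)

Feasible : ∀ {n} → List (Subset n) → List (Subset n) → Set
Feasible S X = All (λ x → x ∈ S) X × AllPairs Disjoint X

Optimum : ∀ {n} → List (Subset n) → List (Subset n) → Set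
Optimum S B = Feasible S B × (∀ C → Feasible S C → wF C ≤ wF B)

N : ∀ {n} → List (Subset n) → List (Subset n) → List (Subset n)
N U W = filter (λ x → Data.List.Relation.Unary.Any.any? (λ u → meets? u x) U) W

LocalImprovement : ∀ {n} → List (Subset n) → List (Subset n) → List (Subset n) → Set
LocalImprovement S A X =
  Feasible S X ×
  (wF (N X A) < wF X ⊎ (wF X ≡ wF (N X A) × count2 (N X A) < count2 X))

NoLocalImprovementUpTo : ∀ {n} → ℕ → List (Subset n) → List (Subset n) → Set
NoLocalImprovementUpTo k S A = ∀ X → length X ≤ k → ¬ LocalImprovement S A X

-- conflict graph: |a ∩ v| parallel edges between a ∈ A and v ∈ B
edges : ∀ {n} → List (Subset n) → Subset n → ℕ
edges A v = sum (map (λ a → ∣ a ∩ v ∣) A)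

nbrs : ∀ {n} → List (Subset n) → Subset n → ℕ
nbrs A v = length (filter (λ a → meets? a v) A)

inB1? : ∀ {n} (A : List (Subset n)) (v : Subset n) → Dec (nbrs A v ≡ 1)
inB1? A v = nbrs A v ≟ 1

inB2? : ∀ {n} (A : List (Subset n)) (v : Subset n) →
        Dec (w v ≡ 2 × edges A v ≡ 2 × nbrs A v ≡ 2)
inB2? A v = (w v ≟ 2) ×-dec ((edges A v ≟ 2) ×-dec (nbrs A v ≟ 2))

receivedFrom : ∀ {n} → List (Subset n) → Subset n → Subset n → ℕ
receivedFrom A u v =
  (if does (inB1? A v) then (if does (meets? u v) then w v else 0) else 0) Data.Nat.+
  (if does (inB2? A v) then ∣ u ∩ v ∣ else 0)

received : ∀ {n} → List (Subset n) → List (Subset n) → Subset n → ℕ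
received A B u = sum (map (receivedFrom A u) B)

{-# OPTIONS --safe #-}
-- Write A as u ∷ O up to permutation and trim every v ∈ B to v ─ ⋃ O. What v sends to u is at
-- most the weight of its trimmed set: a set of B₁ sending to u meets no set of O and loses nothing,
-- and a set of B₂ has three elements and two edges, |u ∩ v| of them to u, so at most 2 - |u ∩ v|
-- of its elements are trimmed. A set that sends to u meets u, so the trimmed senders are at most
-- |u| ≤ 3 pairwise disjoint members of S (by heredity), and u is their only possible neighbour in
-- A. If u received more than w(u), they would be a local improvement of size at most 10.
module Submission where

open import Defs
open import Level using (Level)
open import Data.Bool using (if_then_else_)
open import Data.Fin.Subset using (Subset; ∣_∣; _∩_; _∪_; _─_; ⋃; ⊥; _⊆_; Nonempty; inside; outside)
open import Data.Fin.Subset.Properties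
  using ( ∩-comm; ∩-zeroʳ; ∩-distribˡ-∪; ∣⊥∣≡0; Empty-unique; nonempty?; p⊆q⇒∣p∣≤∣q∣
        ; x∈p∩q⁺; x∈p∩q⁻; p∩q⊆q; ∣p∩q∣≤∣p∣; p─q⊆p; ⊆-refl; ⊆-trans; p⊆p∪q; q⊆p∪q )
open import Data.List using (List; []; _∷_; _++_; map; filter; length)
open import Data.List.Properties
  using (filter-accept; filter-reject; filter-some; filter-none; map-∘; length-map)
open import Data.List.Membership.Propositional using (_∈_)
open import Data.List.Membership.Propositional.Properties using (∈-∃++)
open import Data.List.Relation.Binary.Permutation.Propositional using (_↭_)
open import Data.List.Relation.Binary.Permutation.Propositional.Properties
  using (↭-length; filter-↭; map⁺; shift)
open import Data.List.Relation.Unary.All as All using (All; []; _∷_)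
import Data.List.Relation.Unary.All.Properties as Allₚ
open import Data.List.Relation.Unary.AllPairs as AllPairs using (AllPairs; []; _∷_)
import Data.List.Relation.Unary.AllPairs.Properties as AllPairsₚ
open import Data.List.Relation.Unary.Any using (Any; here; there; any?; satisfied)
import Data.List.Relation.Unary.Any.Properties as Anyₚ
open import Data.Nat using (ℕ; suc; _+_; _∸_; _≤_; z≤n; _≤?_)
open import Data.Nat.ListAction using (sum)
open import Data.Nat.ListAction.Properties using (sum-↭)
open import Data.Nat.Properties
open import Data.Product as Product using (_,_; _×_; ∃; proj₁; proj₂)
open import Data.Sum using (_⊎_; inj₁)
open import Data.Vec using ([]; _∷_)
open import Function using (_∘_)
open import Relation.Binary.PropositionalEquality using (_≡_; refl; sym; trans; cong; cong₂; subst)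
open import Relation.Nullary using (Dec; does; yes; no; ¬_; contradiction)
open import Relation.Unary using (Pred; Decidable; ∁)

private
  variable
    a ℓ : Level
    E : Set a
    n : ℕ
    p p′ q q′ r : Subset n

∣p∪q∣+∣p∩q∣≡∣p∣+∣q∣ : (p q : Subset n) → ∣ p ∪ q ∣ + ∣ p ∩ q ∣ ≡ ∣ p ∣ + ∣ q ∣
∣p∪q∣+∣p∩q∣≡∣p∣+∣q∣ []            []            = refl
∣p∪q∣+∣p∩q∣≡∣p∣+∣q∣ (inside  ∷ p) (inside  ∷ q) =
  cong suc (trans (+-suc _ _) (trans (cong suc (∣p∪q∣+∣p∩q∣≡∣p∣+∣q∣ p q)) (sym (+-suc _ _))))
∣p∪q∣+∣p∩q∣≡∣p∣+∣q∣ (inside  ∷ p) (outside ∷ q) = cong suc (∣p∪q∣+∣p∩q∣≡∣p∣+∣q∣ p q)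
∣p∪q∣+∣p∩q∣≡∣p∣+∣q∣ (outside ∷ p) (inside  ∷ q) =
  trans (cong suc (∣p∪q∣+∣p∩q∣≡∣p∣+∣q∣ p q)) (sym (+-suc _ _))
∣p∪q∣+∣p∩q∣≡∣p∣+∣q∣ (outside ∷ p) (outside ∷ q) = ∣p∪q∣+∣p∩q∣≡∣p∣+∣q∣ p q

∣p∣≡∣p─q∣+∣p∩q∣ : (p q : Subset n) → ∣ p ∣ ≡ ∣ p ─ q ∣ + ∣ p ∩ q ∣
∣p∣≡∣p─q∣+∣p∩q∣ []            []            = refl
∣p∣≡∣p─q∣+∣p∩q∣ (inside  ∷ p) (inside  ∷ q) =
  trans (cong suc (∣p∣≡∣p─q∣+∣p∩q∣ p q)) (sym (+-suc _ _))
∣p∣≡∣p─q∣+∣p∩q∣ (inside  ∷ p) (outside ∷ q) = cong suc (∣p∣≡∣p─q∣+∣p∩q∣ p q)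
∣p∣≡∣p─q∣+∣p∩q∣ (outside ∷ p) (inside  ∷ q) = ∣p∣≡∣p─q∣+∣p∩q∣ p q
∣p∣≡∣p─q∣+∣p∩q∣ (outside ∷ p) (outside ∷ q) = ∣p∣≡∣p─q∣+∣p∩q∣ p q

p─q-disjoint-q : (p q : Subset n) → Disjoint (p ─ q) q
p─q-disjoint-q []            []            = refl
p─q-disjoint-q (_       ∷ p) (inside  ∷ q) = p─q-disjoint-q p q
p─q-disjoint-q (inside  ∷ p) (outside ∷ q) = p─q-disjoint-q p q
p─q-disjoint-q (outside ∷ p) (outside ∷ q) = p─q-disjoint-q p q

∣p∪q∣≤∣p∣+∣q∣ : (p q : Subset n) → ∣ p ∪ q ∣ ≤ ∣ p ∣ + ∣ q ∣
∣p∪q∣≤∣p∣+∣q∣ p q = subst (∣ p ∪ q ∣ ≤_) (∣p∪q∣+∣p∩q∣≡∣p∣+∣q∣ p q) (m≤m+n _ _)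

disjoint⇒∣p∪q∣≡∣p∣+∣q∣ : (p q : Subset n) → Disjoint p q → ∣ p ∪ q ∣ ≡ ∣ p ∣ + ∣ q ∣
disjoint⇒∣p∪q∣≡∣p∣+∣q∣ p q p∩q≡0 =
  trans (sym (trans (cong (∣ p ∪ q ∣ +_) p∩q≡0) (+-identityʳ _))) (∣p∪q∣+∣p∩q∣≡∣p∣+∣q∣ p q)

∩-mono-⊆ : p ⊆ p′ → q ⊆ q′ → p ∩ q ⊆ p′ ∩ q′
∩-mono-⊆ {p = p} {q = q} p⊆p′ q⊆q′ x∈p∩q = x∈p∩q⁺ (Product.map p⊆p′ q⊆q′ (x∈p∩q⁻ p q x∈p∩q))

disjoint-anti-mono : p ⊆ p′ → q ⊆ q′ → Disjoint p′ q′ → Disjoint p q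
disjoint-anti-mono p⊆p′ q⊆q′ d =
  n≤0⇒n≡0 (≤-trans (p⊆q⇒∣p∣≤∣q∣ (∩-mono-⊆ p⊆p′ q⊆q′)) (≤-reflexive d))

p─q-disjoint-⊆q : (p : Subset n) → r ⊆ q → Disjoint (p ─ q) r
p─q-disjoint-⊆q {q = q} p r⊆q = disjoint-anti-mono (⊆-refl {x = p ─ q}) r⊆q (p─q-disjoint-q p q)

disjoint⇒¬meets : (p q : Subset n) → Disjoint p q → ¬ 1 ≤ ∣ p ∩ q ∣
disjoint⇒¬meets p q d = <-irrefl (sym d)

disjoint-⊥ : (p : Subset n) → Disjoint p ⊥
disjoint-⊥ {n} p = trans (cong ∣_∣ (∩-zeroʳ p)) (∣⊥∣≡0 n)

∣p∩[q∪r]∣≤∣p∩q∣+∣p∩r∣ : (p q r : Subset n) → ∣ p ∩ (q ∪ r) ∣ ≤ ∣ p ∩ q ∣ + ∣ p ∩ r ∣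
∣p∩[q∪r]∣≤∣p∩q∣+∣p∩r∣ p q r =
  subst (_≤ ∣ p ∩ q ∣ + ∣ p ∩ r ∣) (cong ∣_∣ (sym (∩-distribˡ-∪ p q r)))
        (∣p∪q∣≤∣p∣+∣q∣ (p ∩ q) (p ∩ r))

∣p∩[q∪r]∣≡∣p∩q∣+∣p∩r∣ : (p : Subset n) → Disjoint q r → ∣ p ∩ (q ∪ r) ∣ ≡ ∣ p ∩ q ∣ + ∣ p ∩ r ∣
∣p∩[q∪r]∣≡∣p∩q∣+∣p∩r∣ {q = q} {r} p d = trans (cong ∣_∣ (∩-distribˡ-∪ p q r))
  (disjoint⇒∣p∪q∣≡∣p∣+∣q∣ (p ∩ q) (p ∩ r) (disjoint-anti-mono (p∩q⊆q p q) (p∩q⊆q p r) d))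

∣p∣>0⇒Nonempty : (p : Subset n) → 1 ≤ ∣ p ∣ → Nonempty p
∣p∣>0⇒Nonempty {n} p 0<∣p∣ with nonempty? p
... | yes ne = ne
... | no ¬ne = contradiction 0<∣p∣ (<-irrefl (sym (trans (cong ∣_∣ (Empty-unique ¬ne)) (∣⊥∣≡0 n))))

∈⇒⊆⋃ : {a : Subset n} {L : List (Subset n)} → a ∈ L → a ⊆ ⋃ L
∈⇒⊆⋃ {L = a ∷ L} (here refl) = p⊆p∪q (⋃ L)
∈⇒⊆⋃ {L = b ∷ L} (there a∈L) = ⊆-trans (∈⇒⊆⋃ a∈L) (q⊆p∪q b (⋃ L))

disjoint-⋃ : {L : List (Subset n)} → All (Disjoint p) L → Disjoint p (⋃ L)
disjoint-⋃ {p = p} [] = disjoint-⊥ p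
disjoint-⋃ {p = p} {a ∷ L} (d ∷ ds) =
  n≤0⇒n≡0 (≤-trans (∣p∩[q∪r]∣≤∣p∩q∣+∣p∩r∣ p a (⋃ L))
                   (≤-reflexive (cong₂ _+_ d (disjoint-⋃ {p = p} ds))))

∈⇒↭∷ : {x : E} {xs : List E} → x ∈ xs → ∃ λ ys → xs ↭ x ∷ ys
∈⇒↭∷ x∈xs with ys , zs , refl ← ∈-∃++ x∈xs = ys ++ zs , shift _ ys zs

sum-map-mono : {f g : E → ℕ} → (∀ x → f x ≤ g x) → (xs : List E) → sum (map f xs) ≤ sum (map g xs)
sum-map-mono f≤g []       = z≤n
sum-map-mono f≤g (x ∷ xs) = +-mono-≤ (f≤g x) (sum-map-mono f≤g xs)

sum-map-filter-positive : (f : E → ℕ) (xs : List E) →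
                          sum (map f (filter (λ x → 1 ≤? f x) xs)) ≡ sum (map f xs)
sum-map-filter-positive f []       = refl
sum-map-filter-positive f (x ∷ xs) with 1 ≤? f x
... | yes fx>0 rewrite filter-accept (λ x → 1 ≤? f x) {xs = xs} fx>0 =
  cong (f x +_) (sum-map-filter-positive f xs)
... | no  fx≯0 rewrite filter-reject (λ x → 1 ≤? f x) {xs = xs} fx≯0 | n≤0⇒n≡0 (≮⇒≥ fx≯0) =
  sum-map-filter-positive f xs

∣v∩⋃L∣≤edges : (L : List (Subset n)) (v : Subset n) → ∣ v ∩ ⋃ L ∣ ≤ edges L v
∣v∩⋃L∣≤edges []      v = ≤-reflexive (disjoint-⊥ v)
∣v∩⋃L∣≤edges (a ∷ L) v = ≤-trans (∣p∩[q∪r]∣≤∣p∩q∣+∣p∩r∣ v a (⋃ L))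
  (+-mono-≤ (≤-reflexive (cong ∣_∣ (∩-comm v a))) (∣v∩⋃L∣≤edges L v))

nbrs-↭ : {A A′ : List (Subset n)} → A ↭ A′ → (v : Subset n) → nbrs A v ≡ nbrs A′ v
nbrs-↭ A↭A′ v = ↭-length (filter-↭ (λ a → meets? a v) A↭A′)

edges-↭ : {A A′ : List (Subset n)} → A ↭ A′ → (v : Subset n) → edges A v ≡ edges A′ v
edges-↭ A↭A′ v = sum-↭ (map⁺ (λ a → ∣ a ∩ v ∣) A↭A′)

nbrs≡0⇒edges≡0 : (L : List (Subset n)) (v : Subset n) → nbrs L v ≡ 0 → edges L v ≡ 0
nbrs≡0⇒edges≡0 L v nbrs≡0 =
  edges≡0 (Allₚ.¬Any⇒All¬ L λ meets-v →
    <-irrefl (sym nbrs≡0) (filter-some (λ a → meets? a v) meets-v))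
  where
  edges≡0 : ∀ {L} → All (λ a → ¬ 1 ≤ ∣ a ∩ v ∣) L → edges L v ≡ 0
  edges≡0 []            = refl
  edges≡0 (a∩v≯0 ∷ ¬ms) = cong₂ _+_ (n≤0⇒n≡0 (≮⇒≥ a∩v≯0)) (edges≡0 ¬ms)

wF-N-↭ : {A A′ : List (Subset n)} → A ↭ A′ → (X : List (Subset n)) → wF (N X A) ≡ wF (N X A′)
wF-N-↭ A↭A′ X = sum-↭ (map⁺ w (filter-↭ (λ a → any? (λ x → meets? x a) X) A↭A′))

data Step1Share (A : List (Subset n)) (u v : Subset n) : ℕ → Set where
  not-sent : Step1Share A u v 0
  from-B₁  : nbrs A v ≡ 1 → 1 ≤ ∣ u ∩ v ∣ → Step1Share A u v (w v)
  from-B₂  : w v ≡ 2 → edges A v ≡ 2 → Step1Share A u v ∣ u ∩ v ∣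

step1Share : (A : List (Subset n)) (u v : Subset n) → Step1Share A u v (receivedFrom A u v)
step1Share A u v = classify (inB1? A v) (inB2? A v) (meets? u v)
  where
  -- 'with inB1? A v' cannot abstract the decision (it unfolds inside the goal), hence this helper.
  classify : (b₁ : Dec (nbrs A v ≡ 1)) (b₂ : Dec (w v ≡ 2 × edges A v ≡ 2 × nbrs A v ≡ 2))
             (m : Dec (1 ≤ ∣ u ∩ v ∣)) →
             Step1Share A u v ((if does b₁ then (if does m then w v else 0) else 0) +
                               (if does b₂ then ∣ u ∩ v ∣ else 0))
  classify (yes b₁) (yes (_ , _ , b₂))    _       = contradiction (trans (sym b₁) b₂) λ ()
  classify (yes b₁) (no _)                (yes m) =
    subst (Step1Share A u v) (sym (+-identityʳ (w v))) (from-B₁ b₁ m)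
  classify (yes _)  (no _)                (no _)  = not-sent
  classify (no _)   (yes (w≡2 , e≡2 , _)) _       = from-B₂ w≡2 e≡2
  classify (no _)   (no _)                _       = not-sent

share>0⇒meets : {A : List (Subset n)} {u v : Subset n} {r : ℕ} →
                Step1Share A u v r → 1 ≤ r → 1 ≤ ∣ u ∩ v ∣
share>0⇒meets (from-B₁ _ u∩v>0) _   = u∩v>0
share>0⇒meets (from-B₂ _ _)     r>0 = r>0

module _ {A O : List (Subset n)} {u : Subset n} (A↭u∷O : A ↭ u ∷ O) where
  open ≤-Reasoning

  B₁-share-≤ : {v : Subset n} → nbrs A v ≡ 1 → 1 ≤ ∣ u ∩ v ∣ → w v ≤ w (v ─ ⋃ O)
  B₁-share-≤ {v} nbrs≡1 u∩v>0 = ∸-monoˡ-≤ 1 (begin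
    ∣ v ∣                     ≡⟨ ∣p∣≡∣p─q∣+∣p∩q∣ v (⋃ O) ⟩
    ∣ v ─ ⋃ O ∣ + ∣ v ∩ ⋃ O ∣ ≤⟨ +-monoʳ-≤ ∣ v ─ ⋃ O ∣ (∣v∩⋃L∣≤edges O v) ⟩
    ∣ v ─ ⋃ O ∣ + edges O v   ≡⟨ cong (∣ v ─ ⋃ O ∣ +_) (nbrs≡0⇒edges≡0 O v nbrsO≡0) ⟩
    ∣ v ─ ⋃ O ∣ + 0           ≡⟨ +-identityʳ _ ⟩
    ∣ v ─ ⋃ O ∣               ∎)
    where
    nbrsO≡0 : nbrs O v ≡ 0
    nbrsO≡0 = suc-injective (begin-equality
      suc (nbrs O v) ≡⟨ cong length (filter-accept (λ a → meets? a v) {x = u} {xs = O} u∩v>0) ⟨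
      nbrs (u ∷ O) v ≡⟨ nbrs-↭ A↭u∷O v ⟨
      nbrs A v       ≡⟨ nbrs≡1 ⟩
      1              ∎)

  B₂-share-≤ : {v : Subset n} → w v ≡ 2 → edges A v ≡ 2 → ∣ u ∩ v ∣ ≤ w (v ─ ⋃ O)
  B₂-share-≤ {v} w≡2 edges≡2 = ∸-monoˡ-≤ 1 (+-cancelʳ-≤ ∣ v ∩ ⋃ O ∣ _ _ (begin
    suc ∣ u ∩ v ∣ + ∣ v ∩ ⋃ O ∣ ≤⟨ +-monoʳ-≤ (suc ∣ u ∩ v ∣) (∣v∩⋃L∣≤edges O v) ⟩
    suc (edges (u ∷ O) v)       ≡⟨ cong suc (trans (sym (edges-↭ A↭u∷O v)) edges≡2) ⟩
    3                           ≡⟨ sym (weight-2⇒size-3 ∣ v ∣ w≡2) ⟩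
    ∣ v ∣                       ≡⟨ ∣p∣≡∣p─q∣+∣p∩q∣ v (⋃ O) ⟩
    ∣ v ─ ⋃ O ∣ + ∣ v ∩ ⋃ O ∣   ∎))
    where
    weight-2⇒size-3 : ∀ m → m ∸ 1 ≡ 2 → m ≡ 3
    weight-2⇒size-3 (suc m) refl = refl

  share-≤ : {v : Subset n} {r : ℕ} → Step1Share A u v r → r ≤ w (v ─ ⋃ O)
  share-≤ not-sent               = z≤n
  share-≤ (from-B₁ nbrs≡1 u∩v>0) = B₁-share-≤ nbrs≡1 u∩v>0
  share-≤ (from-B₂ w≡2 edges≡2)  = B₂-share-≤ w≡2 edges≡2

feasible-filter : {S Bs : List (Subset n)} {P : Pred (Subset n) ℓ} (P? : Decidable P) →
                  Feasible S Bs → Feasible S (filter P? Bs)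
feasible-filter P? (Bs⊆S , disjoint) = Allₚ.filter⁺ P? Bs⊆S , AllPairsₚ.filter⁺ P? disjoint

trim-feasible : {S Bs : List (Subset n)} (W : Subset n) → Hereditary3 S → Feasible S Bs →
                All (λ v → Nonempty (v ─ W)) Bs → Feasible S (map (_─ W) Bs)
trim-feasible W (_ , hereditary) (Bs⊆S , disjoint) nonempty =
  Allₚ.map⁺ (All.zipWith (λ (v∈S , ne) → hereditary _ v∈S _ (p─q⊆p _ W) ne) (Bs⊆S , nonempty)) ,
  AllPairsₚ.map⁺ (AllPairs.map (λ {v} {b} → disjoint-anti-mono (p─q⊆p v W) (p─q⊆p b W)) disjoint)

length≤∣p∩⋃∣ : (p : Subset n) {Bs : List (Subset n)} → AllPairs Disjoint Bs →
               All (λ v → 1 ≤ ∣ p ∩ v ∣) Bs → length Bs ≤ ∣ p ∩ ⋃ Bs ∣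
length≤∣p∩⋃∣ p []                          []                = z≤n
length≤∣p∩⋃∣ p {v ∷ Bs} (v-disjoint ∷ disjoint) (p∩v>0 ∷ meets) = begin
  suc (length Bs)          ≤⟨ +-mono-≤ p∩v>0 (length≤∣p∩⋃∣ p disjoint meets) ⟩
  ∣ p ∩ v ∣ + ∣ p ∩ ⋃ Bs ∣ ≡⟨ ∣p∩[q∪r]∣≡∣p∩q∣+∣p∩r∣ p (disjoint-⋃ {p = v} v-disjoint) ⟨
  ∣ p ∩ (v ∪ ⋃ Bs) ∣       ∎
  where open ≤-Reasoning

wF-filter-∷-≤ : {P : Pred (Subset n) ℓ} (P? : Decidable P) {u : Subset n} {O : List (Subset n)} →
                All (∁ P) O → wF (filter P? (u ∷ O)) ≤ w u
wF-filter-∷-≤ P? {u} ¬PO with P? u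
... | yes _ rewrite filter-none P? ¬PO = ≤-reflexive (+-identityʳ (w u))
... | no  _ rewrite filter-none P? ¬PO = z≤n

wF-N-trimmed-≤ : (u : Subset n) (O Vs : List (Subset n)) → wF (N (map (_─ ⋃ O) Vs) (u ∷ O)) ≤ w u
wF-N-trimmed-≤ u O Vs =
  wF-filter-∷-≤ (λ a → any? (λ y → meets? y a) (map (_─ ⋃ O) Vs)) (All.tabulate missed)
  where
  missed : ∀ {a} → a ∈ O → ¬ Any (λ y → 1 ≤ ∣ y ∩ a ∣) (map (_─ ⋃ O) Vs)
  missed {a} a∈O hit with v , v─⋃O-meets-a ← satisfied (Anyₚ.map⁻ hit) =
    disjoint⇒¬meets (v ─ ⋃ O) a (p─q-disjoint-⊆q v (∈⇒⊆⋃ a∈O)) v─⋃O-meets-a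

module Step1Improvement {n : ℕ} {A O : List (Subset n)} {u : Subset n}
                        (A↭u∷O : A ↭ u ∷ O) (B : List (Subset n)) where
  open ≤-Reasoning

  sends? : (v : Subset n) → Dec (1 ≤ receivedFrom A u v)
  sends? v = 1 ≤? receivedFrom A u v

  senders : List (Subset n)
  senders = filter sends? B

  X : List (Subset n)
  X = map (_─ ⋃ O) senders

  share≤trimmed-weight : (v : Subset n) → receivedFrom A u v ≤ w (v ─ ⋃ O)
  share≤trimmed-weight v = share-≤ A↭u∷O (step1Share A u v)

  received≤wF : received A B u ≤ wF X
  received≤wF = begin
    received A B u                       ≡⟨ sum-map-filter-positive (receivedFrom A u) B ⟨
    sum (map (receivedFrom A u) senders) ≤⟨ sum-map-mono share≤trimmed-weight senders ⟩
    sum (map (w ∘ (_─ ⋃ O)) senders)     ≡⟨ cong sum (map-∘ senders) ⟩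
    wF X                                 ∎

  X-feasible : {S : List (Subset n)} → Hereditary3 S → Feasible S B → Feasible S X
  X-feasible H B-feasible = trim-feasible (⋃ O) H (feasible-filter sends? B-feasible)
    (All.map (λ {v} sends → ∣p∣>0⇒Nonempty (v ─ ⋃ O)
               (≤-trans sends (≤-trans (share≤trimmed-weight v) (m∸n≤m _ 1))))
             (Allₚ.all-filter sends? B))

  senders-meet-u : All (λ v → 1 ≤ ∣ u ∩ v ∣) senders
  senders-meet-u = All.map (λ {v} → share>0⇒meets (step1Share A u v)) (Allₚ.all-filter sends? B)

  X-length≤∣u∣ : AllPairs Disjoint B → length X ≤ ∣ u ∣
  X-length≤∣u∣ disjoint = begin
    length X          ≡⟨ length-map (_─ ⋃ O) senders ⟩
    length senders    ≤⟨ length≤∣p∩⋃∣ u (AllPairsₚ.filter⁺ sends? disjoint) senders-meet-u ⟩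
    ∣ u ∩ ⋃ senders ∣ ≤⟨ ∣p∩q∣≤∣p∣ u (⋃ senders) ⟩
    ∣ u ∣             ∎

  wF-N-X≤w : wF (N X A) ≤ w u
  wF-N-X≤w = begin
    wF (N X A)       ≡⟨ wF-N-↭ A↭u∷O X ⟩
    wF (N X (u ∷ O)) ≤⟨ wF-N-trimmed-≤ u O senders ⟩
    w u              ∎

corollary1 : (n : ℕ) (S A B : List (Subset n)) →
    Hereditary3 S →
    Feasible S A →
    Optimum S B →
    All (λ a → ∣ a ∣ ≡ 2 ⊎ ∣ a ∣ ≡ 3) A →
    All (λ b → ∣ b ∣ ≡ 2 ⊎ ∣ b ∣ ≡ 3) B →
    NoLocalImprovementUpTo 10 S A →
    (u : Subset n) → u ∈ A → received A B u ≤ w u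
corollary1 _ _ A B hereditary A-feasible (B-feasible , _) _ _ no-improvement u u∈A =
  ≮⇒≥ λ wu<received → no-improvement X |X|≤10
    (X-feasible hereditary B-feasible , inj₁ (begin-strict
      wF (N X A)     ≤⟨ wF-N-X≤w ⟩
      w u            <⟨ wu<received ⟩
      received A B u ≤⟨ received≤wF ⟩
      wF X           ∎))
  where
  open ≤-Reasoning
  open Step1Improvement (proj₂ (∈⇒↭∷ u∈A)) B
  ∣u∣≤3 : ∣ u ∣ ≤ 3
  ∣u∣≤3 = proj₂ (All.lookup (proj₁ hereditary) (All.lookup (proj₁ A-feasible) u∈A))
  |X|≤10 : length X ≤ 10
  |X|≤10 = ≤-trans (X-length≤∣u∣ (proj₂ B-feasible)) (≤-trans ∣u∣≤3 (m≤m+n 3 7))
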